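{- For all $n\geq1$, the sum of the first $8n-3$ nonzero Pell numbers is a perfect square, namely $$\sum_{i=1}^{8n-3}P_{i}=\left(\frac{20B_{n+1}^{neobc}+2B_{n}^{neobc}-7C_{n+1}^{neobc}-2R_{n}^{neobc}-19}{6}\right)^{2}.$$
   Context: Pell numbers: $P_0=0$, $P_1=1$, $P_k=2P_{k-1}+P_{k-2}$. A positive integer $m$ is a neo balcobalancing number if there is a positive integer $r$ (its neo balcobalancer) such that $(1+2+\cdots+(m-1))+(1+2+\cdots+m)=2[(m-1)+m+(m+1)+(m+2)+\cdots+(m+r)]$; then $r=\frac{ -2m-1+\sqrt{8m^2-12m+9}}{2}$ (equivalently, $m$ is a neo balcobalancing number iff $8m^2-12m+9$ is a perfect square). $B_n^{neobc}$ denotes the $n$-th neo balcobalancing number in increasing order ($n\ge1$), $R_n^{neobc}$ its neo balcobalancer and $C_n^{neobc}=\sqrt{8(B_n^{neobc})^2-12B_n^{neobc}+9}$. -}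

module Defs where

open import Data.Nat using (ℕ; zero; suc; _+_; _*_; _∸_; _≤_; _<_)
open import Data.Product using (Σ; _×_; ∃)
open import Relation.Binary.PropositionalEquality using (_≡_)

pell : ℕ → ℕ
pell zero = zero
pell (suc zero) = 1
pell (suc (suc k)) = 2 * pell (suc k) + pell k

pellSum : ℕ → ℕ
pellSum zero = zero
pellSum (suc N) = pellSum N + pell (suc N)

sumFrom : ℕ → ℕ → ℕ
sumFrom a zero = zero
sumFrom a (suc l) = a + sumFrom (suc a) l

NeoBalcobalancer : ℕ → ℕ → Set
NeoBalcobalancer m r =
  1 ≤ m × 1 ≤ r × (sumFrom 1 (m ∸ 1) + sumFrom 1 m ≡ 2 * sumFrom (m ∸ 1) (r + 2))

IsNeoBalcobalancing : ℕ → Set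
IsNeoBalcobalancing m = ∃ λ r → NeoBalcobalancer m r

-- B enumerates the neo balcobalancing numbers in increasing order:
-- B 1 < B 2 < ... and {B k | k ≥ 1} is exactly the set of neo balcobalancing numbers.
-- (B 0 is irrelevant.)
IsIncreasingEnumeration : (ℕ → ℕ) → Set
IsIncreasingEnumeration B =
  (∀ i j → 1 ≤ i → i < j → B i < B j)
  × (∀ k → 1 ≤ k → IsNeoBalcobalancing (B k))
  × (∀ m → IsNeoBalcobalancing m → Σ ℕ λ k → 1 ≤ k × B k ≡ m)

-- c = C(m) = sqrt(8 m^2 - 12 m + 9), stated without truncated subtraction
IsC : ℕ → ℕ → Set
IsC m c = c * c + 12 * m ≡ 8 * (m * m) + 9

-- The neo balcobalancing equation is m² + 2 = 2mr + r² + r + 4m.  Its natural solutions form a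
-- single orbit of the affine map (m, r) ↦ (29m + 12r − 6, 12m + 5r − 4), starting at (0, 1): the
-- map preserves the equation, and for m ≥ 6 its inverse produces a strictly smaller solution, so
-- a Vieta-style descent reaches (0, 1).  Hence (B n, R n) is the n-th iterate.  The linear part
-- [[29, 12], [12, 5]] of the map also sends (P k, P (k+1)) to (P (k+4), P (k+5)), and induction
-- gives C n = 3 P (4n−1) and 3 P (4n−2) = 2 B n − 2 R n − 4.  On the Pell side, the addition
-- formula and Cassini's identity give P 1 + ⋯ + P (2k+1) = (P k + P (k+1))² for even k; with
-- k = 4n − 2 the quantity squared in the theorem works out to P (4n−2) + P (4n−1).
module Submission where

open import Defs
open import Data.Empty using (⊥; ⊥-elim)
open import Data.Integer using (ℤ; +_) renaming (_+_ to _+ℤ_; _-_ to _-ℤ_; _*_ to _*ℤ_)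
import Data.Integer.Properties as ℤ
import Data.Integer.Tactic.RingSolver as ℤ-Solver
open import Data.Nat using (ℕ; zero; suc; _+_; _*_; _∸_; _≤_; _<_; s≤s; z≤n; _<?_)
open import Data.Nat.Induction using (<-rec)
open import Data.Nat.Properties
open import Data.Nat.Tactic.RingSolver using (solve-∀)
open import Data.Product using (Σ; _×_; _,_; ∃-syntax; map₂; proj₂)
open import Data.Sum using (_⊎_; inj₁; inj₂)
open import Function.Base using (_∘_)
open import Function.Bundles using (_⇔_; mk⇔; Equivalence)
open import Function.Definitions using (Injective)
open import Relation.Binary.Core using (_Preserves_⟶_)
open import Relation.Binary.Definitions using (tri<; tri≈; tri>)
open import Relation.Binary.PropositionalEquality
open import Relation.Nullary using (yes; no)

-- Semiring reasoning under hypotheses: the ring solver proves a + d ≡ b + c, then c ≡ d is cancelled.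
balance : ∀ {a b c d : ℕ} → a + d ≡ b + c → c ≡ d → a ≡ b
balance {a} {b} {c} {d} identity c≡d = +-cancelʳ-≡ d a b (trans identity (cong (_+_ b) c≡d))

≢+suc : ∀ {x y} k → x ≡ y → y ≡ x + suc k → ⊥
≢+suc {x} k x≡y y≡x+k = m+1+n≢m x (trans (sym y≡x+k) (sym x≡y))

strictMono⇒injective : ∀ {f : ℕ → ℕ} → f Preserves _<_ ⟶ _<_ → Injective _≡_ _≡_ f
strictMono⇒injective f< {i} {j} fi≡fj with <-cmp i j
... | tri< i<j _ _ = ⊥-elim (<⇒≢ (f< i<j) fi≡fj)
... | tri≈ _ i≡j _ = i≡j
... | tri> _ _ j<i = ⊥-elim (<⇒≢ (f< j<i) (sym fi≡fj))

strictMono⇒mono : ∀ {f : ℕ → ℕ} → f Preserves _<_ ⟶ _<_ → f Preserves _≤_ ⟶ _≤_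
strictMono⇒mono f< i≤j with m≤n⇒m<n∨m≡n i≤j
... | inj₁ i<j  = <⇒≤ (f< i<j)
... | inj₂ refl = ≤-refl

<-suc⇒strictMono : ∀ {f : ℕ → ℕ} → (∀ n → f n < f (suc n)) → f Preserves _<_ ⟶ _<_
<-suc⇒strictMono f<f∘suc {i} {suc j} (s≤s i≤j) with m≤n⇒m<n∨m≡n i≤j
... | inj₁ i<j  = <-trans (<-suc⇒strictMono f<f∘suc i<j) (f<f∘suc j)
... | inj₂ refl = f<f∘suc j

strictMono-sameImage⇒≗ : ∀ {f g : ℕ → ℕ} → f Preserves _<_ ⟶ _<_ → g Preserves _<_ ⟶ _<_ →
                         (∀ i → ∃[ j ] f i ≡ g j) → (∀ j → ∃[ i ] g j ≡ f i) → f ≗ g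
strictMono-sameImage⇒≗ {f} {g} f< g< f⊆g g⊆f = <-rec (λ i → f i ≡ g i) λ i f≗g-below →
  ≤-antisym (below g< f< g⊆f i (sym ∘ f≗g-below)) (below f< g< f⊆g i f≗g-below)
  where
  below : ∀ {f g : ℕ → ℕ} → f Preserves _<_ ⟶ _<_ → g Preserves _<_ ⟶ _<_ →
          (∀ i → ∃[ j ] f i ≡ g j) → ∀ i → (∀ {k} → k < i → f k ≡ g k) → g i ≤ f i
  below f< g< f⊆g i f≗g-below with f⊆g i
  ... | j , fi≡gj with j <? i
  ...   | yes j<i = ⊥-elim (<⇒≢ j<i (strictMono⇒injective f< (trans (f≗g-below j<i) (sym fi≡gj))))
  ...   | no j≮i  = subst (_ ≤_) (sym fi≡gj) (strictMono⇒mono g< (≮⇒≥ j≮i))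

pell-+ : ∀ a b → pell (suc (a + b)) ≡ pell (suc a) * pell (suc b) + pell a * pell b
pell-+ zero b = identity (pell (suc b)) (pell b)
  where identity : ∀ q p → q ≡ 1 * q + 0 * p
        identity = solve-∀
pell-+ (suc zero) b = identity (pell (suc b)) (pell b)
  where identity : ∀ q p → 2 * q + p ≡ 2 * q + 1 * p
        identity = solve-∀
pell-+ (suc (suc a)) b =
  trans (cong₂ (λ x y → 2 * x + y) (pell-+ (suc a) b) (pell-+ a b))
        (identity (pell (suc a)) (pell a) (pell (suc b)) (pell b))
  where identity : ∀ p₁ p₀ q₁ q₀ → 2 * ((2 * p₁ + p₀) * q₁ + p₁ * q₀) + (p₁ * q₁ + p₀ * q₀)
                                  ≡ (2 * (2 * p₁ + p₀) + p₁) * q₁ + (2 * p₁ + p₀) * q₀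
        identity = solve-∀

-- P (k+1)² − 2 P k P (k+1) − P k² = 1, which holds exactly for even k.
PellCassini : ℕ → Set
PellCassini k = pell (suc k) * pell (suc k) ≡ 2 * pell k * pell (suc k) + pell k * pell k + 1

pellCassini-even : ∀ i → PellCassini (i * 2)
pellCassini-even zero    = refl
pellCassini-even (suc i) = balance (identity (pell (i * 2)) (pell (suc (i * 2)))) (pellCassini-even i)
  where identity : ∀ p q → (2 * (2 * q + p) + q) * (2 * (2 * q + p) + q) + (2 * p * q + p * p + 1)
                         ≡ 2 * (2 * q + p) * (2 * (2 * q + p) + q) + (2 * q + p) * (2 * q + p) + 1 + q * q
        identity = solve-∀

2*pellSum+1 : ∀ N → 2 * pellSum N + 1 ≡ pell N + pell (suc N)
2*pellSum+1 zero    = refl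
2*pellSum+1 (suc N) =
  trans (identity₁ (pellSum N) (pell (suc N)))
        (trans (cong (_+ 2 * pell (suc N)) (2*pellSum+1 N)) (identity₂ (pell N) (pell (suc N))))
  where identity₁ : ∀ s x → 2 * (s + x) + 1 ≡ (2 * s + 1) + 2 * x
        identity₁ = solve-∀
        identity₂ : ∀ a b → (a + b) + 2 * b ≡ b + (2 * b + a)
        identity₂ = solve-∀

pellSum-square : ∀ k → PellCassini k →
                 pellSum (suc (k + k)) ≡ (pell (suc k) + pell k) * (pell (suc k) + pell k)
pellSum-square k cassini = *-cancelˡ-≡ _ _ 2 (+-cancelʳ-≡ 1 _ _ (begin
    2 * pellSum (suc (k + k)) + 1
  ≡⟨ 2*pellSum+1 (suc (k + k)) ⟩
    pell (suc (k + k)) + pell (suc (suc k + k))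
  ≡⟨ cong₂ _+_ (pell-+ k k) (pell-+ (suc k) k) ⟩
    (q * q + p * p) + ((2 * q + p) * q + q * p)
  ≡⟨ balance (identity p q) cassini ⟩
    2 * ((q + p) * (q + p)) + 1 ∎))
  where
  open ≡-Reasoning
  p = pell k
  q = pell (suc k)
  identity : ∀ p q → (q * q + p * p) + ((2 * q + p) * q + q * p) + (2 * p * q + p * p + 1)
                   ≡ 2 * ((q + p) * (q + p)) + 1 + q * q
  identity = solve-∀

NeoEquation : ℕ → ℕ → Set
NeoEquation m r = m * m + 2 ≡ 2 * m * r + r * r + r + 4 * m

sumFrom-double : ∀ a l → 2 * sumFrom a l + l ≡ l * (2 * a + l)
sumFrom-double a zero    = refl
sumFrom-double a (suc l) = balance (identity a l (sumFrom (suc a) l)) (sumFrom-double (suc a) l)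
  where identity : ∀ a l s → (2 * (a + s) + (1 + l)) + l * (2 * (1 + a) + l)
                           ≡ (1 + l) * (2 * a + (1 + l)) + (2 * s + l)
        identity = solve-∀

sumFrom-1-pred+sumFrom-1 : ∀ m₀ → sumFrom 1 m₀ + sumFrom 1 (suc m₀) ≡ suc m₀ * suc m₀
sumFrom-1-pred+sumFrom-1 m₀ = *-cancelˡ-≡ _ _ 2
  (balance (identity (sumFrom 1 m₀) (sumFrom 1 (suc m₀)) m₀)
           (cong₂ _+_ (sumFrom-double 1 m₀) (sumFrom-double 1 (suc m₀))))
  where identity : ∀ s t m₀ → 2 * (s + t) + (m₀ * (2 + m₀) + (1 + m₀) * (2 + (1 + m₀)))
                            ≡ 2 * ((1 + m₀) * (1 + m₀)) + ((2 * s + m₀) + (2 * t + (1 + m₀)))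
        identity = solve-∀

2*sumFrom-pred+2 : ∀ m₀ r → 2 * sumFrom m₀ (r + 2) + 2 ≡ 2 * suc m₀ * r + r * r + r + 4 * suc m₀
2*sumFrom-pred+2 m₀ r = balance (identity m₀ r (sumFrom m₀ (r + 2))) (sumFrom-double m₀ (r + 2))
  where identity : ∀ m₀ r s → (2 * s + 2) + (r + 2) * (2 * m₀ + (r + 2))
                            ≡ (2 * (1 + m₀) * r + r * r + r + 4 * (1 + m₀)) + (2 * s + (r + 2))
        identity = solve-∀

sumEquation⇔neoEquation : ∀ m₀ r →
  (sumFrom 1 m₀ + sumFrom 1 (suc m₀) ≡ 2 * sumFrom m₀ (r + 2)) ⇔ NeoEquation (suc m₀) r
sumEquation⇔neoEquation m₀ r = mk⇔
  (λ e → trans (cong (_+ 2) (trans (sym (sumFrom-1-pred+sumFrom-1 m₀)) e)) (2*sumFrom-pred+2 m₀ r))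
  (λ e → trans (sumFrom-1-pred+sumFrom-1 m₀) (+-cancelʳ-≡ 2 _ _ (trans e (sym (2*sumFrom-pred+2 m₀ r)))))

neoBalcobalancer⇔ : ∀ m r → NeoBalcobalancer m r ⇔ (1 ≤ m × 1 ≤ r × NeoEquation m r)
neoBalcobalancer⇔ zero     r = mk⇔ (λ { (() , _) }) (λ { (() , _) })
neoBalcobalancer⇔ (suc m₀) r = mk⇔ (map₂ (map₂ to)) (map₂ (map₂ from))
  where open Equivalence (sumEquation⇔neoEquation m₀ r)

record Step (m r m′ r′ : ℕ) : Set where
  constructor mkStep
  field
    next-m : m′ + 6 ≡ 29 * m + 12 * r
    next-r : r′ + 4 ≡ 12 * m + 5 * r

step-functional : ∀ {m r m₁ r₁ m₂ r₂} → Step m r m₁ r₁ → Step m r m₂ r₂ → m₁ ≡ m₂ × r₁ ≡ r₂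
step-functional (mkStep m₁+6 r₁+4) (mkStep m₂+6 r₂+4) =
  +-cancelʳ-≡ 6 _ _ (trans m₁+6 (sym m₂+6)) , +-cancelʳ-≡ 4 _ _ (trans r₁+4 (sym r₂+4))

ShiftedEquation : ℕ → ℕ → Set
ShiftedEquation M R = M * M + 19 * R + 2 ≡ 2 * M * R + R * R + 8 * M

neoEquation⇔shifted : ∀ m r → NeoEquation m r ⇔ ShiftedEquation (m + 6) (r + 4)
neoEquation⇔shifted m r = mk⇔ (balance (identity₁ m r)) (balance (identity₂ m r))
  where
  identity₁ : ∀ m r → ((m + 6) * (m + 6) + 19 * (r + 4) + 2) + (2 * m * r + r * r + r + 4 * m)
                    ≡ (2 * (m + 6) * (r + 4) + (r + 4) * (r + 4) + 8 * (m + 6)) + (m * m + 2)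
  identity₁ = solve-∀
  identity₂ : ∀ m r → (m * m + 2) + (2 * (m + 6) * (r + 4) + (r + 4) * (r + 4) + 8 * (m + 6))
                    ≡ (2 * m * r + r * r + r + 4 * m) + ((m + 6) * (m + 6) + 19 * (r + 4) + 2)
  identity₂ = solve-∀

shifted⇔neoEquation : ∀ m r → ShiftedEquation (29 * m + 12 * r) (12 * m + 5 * r) ⇔ NeoEquation m r
shifted⇔neoEquation m r = mk⇔ (balance (identity₁ m r)) (balance (identity₂ m r))
  where
  identity₁ : ∀ m r → let M = 29 * m + 12 * r; R = 12 * m + 5 * r in
              (m * m + 2) + (2 * M * R + R * R + 8 * M) ≡ (2 * m * r + r * r + r + 4 * m) + (M * M + 19 * R + 2)
  identity₁ = solve-∀
  identity₂ : ∀ m r → let M = 29 * m + 12 * r; R = 12 * m + 5 * r in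
              (M * M + 19 * R + 2) + (2 * m * r + r * r + r + 4 * m) ≡ (2 * M * R + R * R + 8 * M) + (m * m + 2)
  identity₂ = solve-∀

step-preserves : ∀ {m r m′ r′} → Step m r m′ r′ → NeoEquation m r ⇔ NeoEquation m′ r′
step-preserves {m} {r} {m′} {r′} (mkStep m′+6 r′+4) = mk⇔
  (λ e → from (neoEquation⇔shifted m′ r′) (subst₂ ShiftedEquation (sym m′+6) (sym r′+4) (from (shifted⇔neoEquation m r) e)))
  (λ e → to (shifted⇔neoEquation m r) (subst₂ ShiftedEquation m′+6 r′+4 (to (neoEquation⇔shifted m′ r′) e)))
  where open Equivalence

-- neoS n = neoR n − 1, tracked instead of neoR so that the recursion needs no subtraction.
mutual
  neoB : ℕ → ℕ
  neoB zero    = 0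
  neoB (suc n) = 29 * neoB n + 12 * neoS n + 6

  neoS : ℕ → ℕ
  neoS zero    = 0
  neoS (suc n) = 12 * neoB n + 5 * neoS n

neoR : ℕ → ℕ
neoR n = suc (neoS n)

orbit-step : ∀ n → Step (neoB n) (neoR n) (neoB (suc n)) (neoR (suc n))
orbit-step n = mkStep (identity₁ (neoB n) (neoS n)) (identity₂ (neoB n) (neoS n))
  where
  identity₁ : ∀ m s → 29 * m + 12 * s + 6 + 6 ≡ 29 * m + 12 * suc s
  identity₁ = solve-∀
  identity₂ : ∀ m s → suc (12 * m + 5 * s) + 4 ≡ 12 * m + 5 * suc s
  identity₂ = solve-∀

orbit-neoEquation : ∀ n → NeoEquation (neoB n) (neoR n)
orbit-neoEquation zero    = refl
orbit-neoEquation (suc n) = Equivalence.to (step-preserves (orbit-step n)) (orbit-neoEquation n)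

neoB-strictMono : neoB Preserves _<_ ⟶ _<_
neoB-strictMono = <-suc⇒strictMono λ n → subst (neoB n <_) (sym (identity (neoB n) (neoS n))) (s≤s (m≤m+n (neoB n) _))
  where identity : ∀ m s → 29 * m + 12 * s + 6 ≡ suc (m + (28 * m + 12 * s + 5))
        identity = solve-∀

6m≤m²+2 : ∀ m r → NeoEquation m (suc r) → 6 * m ≤ m * m + 2
6m≤m²+2 m r e = subst (6 * m ≤_) (sym (trans e (identity m r))) (m≤m+n (6 * m) _)
  where identity : ∀ m r → 2 * m * (1 + r) + (1 + r) * (1 + r) + (1 + r) + 4 * m
                         ≡ 6 * m + (2 * m * r + (1 + r) * (1 + r) + (1 + r))
        identity = solve-∀

zero-or-≥6 : ∀ m r → NeoEquation m r → m ≡ 0 ⊎ 6 ≤ m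
zero-or-≥6 0 r _ = inj₁ refl
zero-or-≥6 1 0 ()
zero-or-≥6 2 0 ()
zero-or-≥6 3 0 ()
zero-or-≥6 4 0 ()
zero-or-≥6 5 0 ()
-- For 1 ≤ m ≤ 5 the inequality 6m ≤ m² + 2 is closed and false; ≤⇒≤ᵇ evaluates it to ⊥.
zero-or-≥6 1 (suc r) e = ⊥-elim (≤⇒≤ᵇ (6m≤m²+2 1 r e))
zero-or-≥6 2 (suc r) e = ⊥-elim (≤⇒≤ᵇ (6m≤m²+2 2 r e))
zero-or-≥6 3 (suc r) e = ⊥-elim (≤⇒≤ᵇ (6m≤m²+2 3 r e))
zero-or-≥6 4 (suc r) e = ⊥-elim (≤⇒≤ᵇ (6m≤m²+2 4 r e))
zero-or-≥6 5 (suc r) e = ⊥-elim (≤⇒≤ᵇ (6m≤m²+2 5 r e))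
zero-or-≥6 (suc (suc (suc (suc (suc (suc m)))))) r _ = inj₂ (m≤m+n 6 m)

neoEquation-zero : ∀ r → NeoEquation 0 r → r ≡ 1
neoEquation-zero r e = strictMono⇒injective (λ i<j → +-mono-< (*-mono-< i<j i<j) i<j) (sym (trans e (+-identityʳ _)))

5m<12r+18-impossible : ∀ f r d → NeoEquation (6 + f) r → suc (5 * (6 + f) + d) ≡ 12 * r + 18 → ⊥
5m<12r+18-impossible f r d E H =
  ≢+suc (180 + 70 * f + f * f + 182 * d + 34 * f * d + d * d)
    (subst (λ t → 144 * (m * m + 2) + 24 * t ≡ 24 * m * t + t * t + 144 * m + 108) (sym H)
           (trans (cong (λ x → 144 * x + 24 * (12 * r + 18)) E) (scaled m r)))
    (positive f d)
  where
  m = 6 + f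
  scaled : ∀ m r → 144 * (2 * m * r + r * r + r + 4 * m) + 24 * (12 * r + 18)
                 ≡ 24 * m * (12 * r + 18) + (12 * r + 18) * (12 * r + 18) + 144 * m + 108
  scaled = solve-∀
  positive : ∀ f d → let m = 6 + f; t = suc (5 * m + d) in
             24 * m * t + t * t + 144 * m + 108
             ≡ (144 * (m * m + 2) + 24 * t) + suc (180 + 70 * f + f * f + 182 * d + 34 * f * d + d * d)
  positive = solve-∀

12r+18≤5m : ∀ {m r} → 6 ≤ m → NeoEquation m r → 12 * r + 18 ≤ 5 * m
12r+18≤5m {r = r} 6≤m E with m≤n⇒∃[o]m+o≡n 6≤m
... | f , refl = ≮⇒≥ λ lt → let d , H = m≤n⇒∃[o]m+o≡n lt in 5m<12r+18-impossible f r d E H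

12r+18≤4m-impossible : ∀ m r e → NeoEquation m r → 12 * r + 18 + e ≡ 4 * m → ⊥
12r+18≤4m-impossible m r e E H =
  ≢+suc (32 * r * r + 80 * r + 16 * r * e + e * e + 20 * e + 67)
    (sym (subst (λ u → u * u + 32 ≡ 8 * r * u + 16 * r * r + 16 * r + 16 * u) (sym H)
           (trans (square m) (trans (cong (16 *_) E) (scaled m r)))))
    (positive r e)
  where
  square : ∀ m → 4 * m * (4 * m) + 32 ≡ 16 * (m * m + 2)
  square = solve-∀
  scaled : ∀ m r → 16 * (2 * m * r + r * r + r + 4 * m) ≡ 8 * r * (4 * m) + 16 * r * r + 16 * r + 16 * (4 * m)
  scaled = solve-∀
  positive : ∀ r e → let u = 12 * r + 18 + e in
             u * u + 32 ≡ (8 * r * u + 16 * r * r + 16 * r + 16 * u) + suc (32 * r * r + 80 * r + 16 * r * e + e * e + 20 * e + 67)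
  positive = solve-∀

4m<12r+18 : ∀ {m r} → NeoEquation m r → 4 * m < 12 * r + 18
4m<12r+18 {m} {r} E = ≰⇒> λ le → let e , H = m≤n⇒∃[o]m+o≡n le in 12r+18≤4m-impossible m r e E H

29r+44<12m-impossible : ∀ m r d → NeoEquation m r → suc (29 * r + 44 + d) ≡ 12 * m → ⊥
29r+44<12m-impossible m r d E H =
  let k , gap = positive r d in
  ≢+suc k (sym (subst (λ u → u * u + 288 ≡ 24 * r * u + 144 * r * r + 144 * r + 48 * u) (sym H)
                      (trans (square m) (trans (cong (144 *_) E) (scaled m r)))))
          gap
  where
  square : ∀ m → 12 * m * (12 * m) + 288 ≡ 144 * (m * m + 2)
  square = solve-∀
  scaled : ∀ m r → 144 * (2 * m * r + r * r + r + 4 * m) ≡ 24 * r * (12 * m) + 144 * r * r + 144 * r + 48 * (12 * m)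
  scaled = solve-∀
  Gap : ℕ → ℕ → ℕ → Set
  Gap r d k = let u = suc (29 * r + 44 + d) in
              u * u + 288 ≡ (24 * r * u + 144 * r * r + 144 * r + 48 * u) + suc k
  -- the gap is (r − 3)² + 144 + 34rd + 42d + d², so r < 3 is treated separately
  positive : ∀ r d → ∃[ k ] Gap r d k
  positive 0 d = 152 + 42 * d + d * d , gap d
    where gap : ∀ d → let u = suc (29 * 0 + 44 + d) in
                u * u + 288 ≡ (24 * 0 * u + 144 * 0 * 0 + 144 * 0 + 48 * u) + suc (152 + 42 * d + d * d)
          gap = solve-∀
  positive 1 d = 147 + 76 * d + d * d , gap d
    where gap : ∀ d → let u = suc (29 * 1 + 44 + d) in
                u * u + 288 ≡ (24 * 1 * u + 144 * 1 * 1 + 144 * 1 + 48 * u) + suc (147 + 76 * d + d * d)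
          gap = solve-∀
  positive 2 d = 144 + 110 * d + d * d , gap d
    where gap : ∀ d → let u = suc (29 * 2 + 44 + d) in
                u * u + 288 ≡ (24 * 2 * u + 144 * 2 * 2 + 144 * 2 + 48 * u) + suc (144 + 110 * d + d * d)
          gap = solve-∀
  positive (suc (suc (suc g))) d = 143 + g * g + 34 * (3 + g) * d + 42 * d + d * d , gap g d
    where gap : ∀ g d → let r = 3 + g; u = suc (29 * r + 44 + d) in
                u * u + 288 ≡ (24 * r * u + 144 * r * r + 144 * r + 48 * u) + suc (143 + g * g + 34 * r * d + 42 * d + d * d)
          gap = solve-∀

12m≤29r+44 : ∀ {m r} → NeoEquation m r → 12 * m ≤ 29 * r + 44
12m≤29r+44 {m} {r} E = ≮⇒≥ λ lt → let d , H = m≤n⇒∃[o]m+o≡n lt in 29r+44<12m-impossible m r d E H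

-- Opaque: matching on the witnesses would otherwise unfold the ring-solver proofs inside them.
opaque
  descent : ∀ {m r} → 6 ≤ m → NeoEquation m r → ∃[ m′ ] ∃[ r′ ] m′ < m × NeoEquation m′ r′ × Step m′ r′ m r
  descent {m} {r} 6≤m E = m′ , r′ , m′<m , Equivalence.from (step-preserves step) E , step
    where
    m′ r′ : ℕ
    m′ = 5 * m ∸ (12 * r + 18)
    r′ = 29 * r + 44 ∸ 12 * m
    m′+ : m′ + (12 * r + 18) ≡ 5 * m
    m′+ = m∸n+n≡m (12r+18≤5m {m} {r} 6≤m E)
    r′+ : r′ + 12 * m ≡ 29 * r + 44
    r′+ = m∸n+n≡m (12m≤29r+44 {m} {r} E)
    step : Step m′ r′ m r
    step = mkStep
      (balance (identity₁ m r m′ r′) (cong₂ (λ x y → 29 * x + 12 * y) (sym m′+) (sym r′+)))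
      (balance (identity₂ m r m′ r′) (cong₂ (λ x y → 12 * x + 5 * y) (sym m′+) (sym r′+)))
      where
      identity₁ : ∀ m r m′ r′ → (m + 6) + (29 * (m′ + (12 * r + 18)) + 12 * (r′ + 12 * m))
                              ≡ (29 * m′ + 12 * r′) + (29 * (5 * m) + 12 * (29 * r + 44))
      identity₁ = solve-∀
      identity₂ : ∀ m r m′ r′ → (r + 4) + (12 * (m′ + (12 * r + 18)) + 5 * (r′ + 12 * m))
                              ≡ (12 * m′ + 5 * r′) + (12 * (5 * m) + 5 * (29 * r + 44))
      identity₂ = solve-∀
    m′<m : m′ < m
    m′<m = +-cancelʳ-< (12 * r + 18) m′ m
             (subst (_< m + (12 * r + 18)) (trans (identity m) (sym m′+)) (+-monoʳ-< m (4m<12r+18 {m} {r} E)))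
      where identity : ∀ m → m + 4 * m ≡ 5 * m
            identity = solve-∀

neoEquation⇒orbit : ∀ m r → NeoEquation m r → ∃[ n ] m ≡ neoB n × r ≡ neoR n
neoEquation⇒orbit = <-rec _ classify
  where
  classify : ∀ m → (∀ {m′} → m′ < m → ∀ r → NeoEquation m′ r → ∃[ n ] m′ ≡ neoB n × r ≡ neoR n) →
             ∀ r → NeoEquation m r → ∃[ n ] m ≡ neoB n × r ≡ neoR n
  classify m below r E with zero-or-≥6 m r E
  ... | inj₁ refl = 0 , refl , neoEquation-zero r E
  ... | inj₂ 6≤m with descent {m} {r} 6≤m E
  ...   | m′ , r′ , m′<m , E′ , step with below m′<m r′ E′
  ...     | n , refl , refl = suc n , step-functional step (orbit-step n)

neoR-determined : ∀ {m r n} → NeoEquation m r → m ≡ neoB n → r ≡ neoR n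
neoR-determined {m} {r} {n} E m≡neoB with neoEquation⇒orbit m r E
... | n′ , refl , refl = cong neoR (strictMono⇒injective neoB-strictMono {n′} {n} m≡neoB)

neoBalcobalancing⇒orbit : ∀ m → IsNeoBalcobalancing m → ∃[ n ] m ≡ neoB (suc n)
neoBalcobalancing⇒orbit m (r , nb) with Equivalence.to (neoBalcobalancer⇔ m r) nb
... | 1≤m , _ , E with neoEquation⇒orbit m r E
...   | suc n , m≡neoB , _ = n , m≡neoB
...   | zero  , m≡0    , _ = ⊥-elim (<⇒≢ 1≤m (sym m≡0))

orbit-neoBalcobalancing : ∀ n → IsNeoBalcobalancing (neoB (suc n))
orbit-neoBalcobalancing n = neoR (suc n) , Equivalence.from (neoBalcobalancer⇔ (neoB (suc n)) (neoR (suc n)))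
  (≤-trans (s≤s z≤n) (m≤n+m 6 _) , s≤s z≤n , orbit-neoEquation (suc n))

enumeration≗orbit : ∀ B → IsIncreasingEnumeration B → ∀ n → B (suc n) ≡ neoB (suc n)
enumeration≗orbit B (B< , B-neo , B-onto) = strictMono-sameImage⇒≗ B∘suc-strictMono neoB∘suc-strictMono
  (λ i → neoBalcobalancing⇒orbit (B (suc i)) (B-neo (suc i) (s≤s z≤n)))
  orbit⊆B
  where
  B∘suc-strictMono : (B ∘ suc) Preserves _<_ ⟶ _<_
  B∘suc-strictMono {i} {j} i<j = B< (suc i) (suc j) (s≤s z≤n) (s≤s i<j)
  neoB∘suc-strictMono : (neoB ∘ suc) Preserves _<_ ⟶ _<_
  neoB∘suc-strictMono i<j = neoB-strictMono (s≤s i<j)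
  orbit⊆B : ∀ j → ∃[ i ] neoB (suc j) ≡ B (suc i)
  orbit⊆B j = index-pred (B-onto (neoB (suc j)) (orbit-neoBalcobalancing j))
    where index-pred : (Σ ℕ λ k → 1 ≤ k × B k ≡ neoB (suc j)) → ∃[ i ] neoB (suc j) ≡ B (suc i)
          index-pred (suc i , _ , B≡neoB) = i , sym B≡neoB

isC-determined : ∀ {m r c} → NeoEquation m r → IsC m c → c ≡ 2 * m + 2 * r + 1
isC-determined {m} {r} {c} E isC =
  strictMono⇒injective (λ i<j → *-mono-< i<j i<j)
    (+-cancelʳ-≡ (12 * m) _ _ (trans isC (sym (balance (identity m r) (cong (4 *_) (sym E))))))
  where identity : ∀ m r → (2 * m + 2 * r + 1) * (2 * m + 2 * r + 1) + 12 * m + 4 * (m * m + 2)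
                         ≡ 8 * (m * m) + 9 + 4 * (2 * m * r + r * r + r + 4 * m)
        identity = solve-∀

orbit-pell : ∀ j → let m = neoB (suc j); r = neoR (suc j) in
             3 * pell (3 + j * 4) ≡ 2 * m + 2 * r + 1 × 3 * pell (2 + j * 4) + 2 * r + 4 ≡ 2 * m
orbit-pell zero    = refl , refl
orbit-pell (suc j) with orbit-pell j
... | c≡ , b≡ =
  trans (cong (3 *_) (pell-+ 4 k)) (balance (identity₁ m s p q) (cong₂ (λ x y → 29 * x + 12 * y) c≡ b≡)) ,
  trans (cong (λ x → 3 * x + 2 * neoR (suc (suc j)) + 4) (pell-+ 3 k))
        (balance (identity₂ m s p q) (cong₂ (λ x y → 12 * x + 5 * y) c≡ b≡))
  where
  k = 2 + j * 4
  m = neoB (suc j)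
  s = neoS (suc j)
  p = pell k
  q = pell (suc k)
  identity₁ : ∀ m s p q → 3 * (29 * q + 12 * p) + (29 * (2 * m + 2 * suc s + 1) + 12 * (2 * m))
                        ≡ 2 * (29 * m + 12 * s + 6) + 2 * suc (12 * m + 5 * s) + 1 + (29 * (3 * q) + 12 * (3 * p + 2 * suc s + 4))
  identity₁ = solve-∀
  identity₂ : ∀ m s p q → 3 * (12 * q + 5 * p) + 2 * suc (12 * m + 5 * s) + 4 + (12 * (2 * m + 2 * suc s + 1) + 5 * (2 * m))
                        ≡ 2 * (29 * m + 12 * s + 6) + (12 * (3 * q) + 5 * (3 * p + 2 * suc s + 4))
  identity₂ = solve-∀

numerator-identity : ∀ j {X Y c r} → X ≡ neoB (suc (suc j)) → Y ≡ neoB (suc j) →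
  c ≡ 2 * neoB (suc (suc j)) + 2 * neoR (suc (suc j)) + 1 → r ≡ neoR (suc j) →
  20 * X + 2 * Y ≡ 7 * c + 2 * r + 19 + 6 * (pell (3 + j * 4) + pell (2 + j * 4))
numerator-identity j refl refl refl refl with orbit-pell j
... | c≡ , b≡ = balance (identity (neoB (suc j)) (neoS (suc j)) (pell (2 + j * 4)) (pell (3 + j * 4)))
                        (sym (cong₂ (λ x y → 2 * x + 2 * y) c≡ b≡))
  where identity : ∀ m s p q → let M = 29 * m + 12 * s + 6 in
                   20 * M + 2 * m + (2 * (3 * q) + 2 * (3 * p + 2 * suc s + 4))
                   ≡ 7 * (2 * M + 2 * suc (12 * m + 5 * s) + 1) + 2 * suc s + 19 + 6 * (q + p)
                     + (2 * (2 * m + 2 * suc s + 1) + 2 * (2 * m))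
        identity = solve-∀

ℕ-identity⇒ℤ : ∀ X Y c r K → 20 * X + 2 * Y ≡ 7 * c + 2 * r + 19 + 6 * K →
  (+ 20) *ℤ (+ X) +ℤ (+ 2) *ℤ (+ Y) -ℤ (+ 7) *ℤ (+ c) -ℤ (+ 2) *ℤ (+ r) -ℤ (+ 19) ≡ (+ 6) *ℤ (+ K)
ℕ-identity⇒ℤ X Y c r K e
  rewrite sym (ℤ.pos-* 20 X) | sym (ℤ.pos-* 2 Y) | sym (ℤ.pos-* 7 c) | sym (ℤ.pos-* 2 r) | sym (ℤ.pos-* 6 K) =
  trans (cong (λ z → z -ℤ + (7 * c) -ℤ + (2 * r) -ℤ + 19) (cong +_ e))
        (cancel (+ (7 * c)) (+ (2 * r)) (+ 19) (+ (6 * K)))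
  where cancel : ∀ a b c d → a +ℤ b +ℤ c +ℤ d -ℤ a -ℤ b -ℤ c ≡ d
        cancel = ℤ-Solver.solve-∀

pellSum-8n-3 : ∀ j → pellSum (8 * suc j ∸ 3) ≡ (pell (3 + j * 4) + pell (2 + j * 4)) * (pell (3 + j * 4) + pell (2 + j * 4))
pellSum-8n-3 j = trans (cong pellSum index) (pellSum-square k cassini)
  where
  k = 2 + j * 4
  index : 8 * suc j ∸ 3 ≡ suc (k + k)
  index = trans (cong (_∸ 3) (identity j)) (m+n∸m≡n 3 _)
    where identity : ∀ j → 8 * suc j ≡ 3 + suc ((2 + j * 4) + (2 + j * 4))
          identity = solve-∀
  cassini : PellCassini k
  cassini = subst (λ i → PellCassini (2 + i)) (*-assoc j 2 2) (pellCassini-even (suc (j * 2)))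

theorem9p2 : (B : ℕ → ℕ) → IsIncreasingEnumeration B →
    (n : ℕ) → 1 ≤ n →
    (r : ℕ) → NeoBalcobalancer (B n) r →
    (c' : ℕ) → IsC (B (n + 1)) c' →
    Σ ℤ λ k →
      ((+ 20) *ℤ (+ B (n + 1)) +ℤ (+ 2) *ℤ (+ B n) -ℤ (+ 7) *ℤ (+ c') -ℤ (+ 2) *ℤ (+ r) -ℤ (+ 19) ≡ (+ 6) *ℤ k)
      × (+ pellSum (8 * n ∸ 3) ≡ k *ℤ k)
theorem9p2 B enum (suc j) _ r nb c' isC =
  + K ,
  ℕ-identity⇒ℤ (B (suc j + 1)) (B (suc j)) c' r K (numerator-identity j Bₙ₊₁ Bₙ c'≡ r≡) ,
  trans (cong +_ (pellSum-8n-3 j)) (ℤ.pos-* K K)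
  where
  K = pell (3 + j * 4) + pell (2 + j * 4)
  Bₙ : B (suc j) ≡ neoB (suc j)
  Bₙ = enumeration≗orbit B enum j
  Bₙ₊₁ : B (suc j + 1) ≡ neoB (suc (suc j))
  Bₙ₊₁ = trans (cong B (+-comm (suc j) 1)) (enumeration≗orbit B enum (suc j))
  r≡ : r ≡ neoR (suc j)
  r≡ = neoR-determined {B (suc j)} {r} {suc j} (proj₂ (proj₂ (Equivalence.to (neoBalcobalancer⇔ (B (suc j)) r) nb))) Bₙ
  c'≡ : c' ≡ 2 * neoB (suc (suc j)) + 2 * neoR (suc (suc j)) + 1
  c'≡ = isC-determined {neoB (suc (suc j))} {neoR (suc (suc j))} {c'} (orbit-neoEquation (suc (suc j))) (subst (λ m → IsC m c') Bₙ₊₁ isC)
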